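{- Let $\mathbf{P}\colon\mathsf{C}^{\mathrm{op}}\to\mathsf{BA}$ be a Boolean doctrine and $(F_X)_{X\in\mathsf{C}}$ a universal ultrafilter for $\mathbf{P}$ such that $\mathbf{P}$ is rich with respect to $(F_X)_{X\in\mathsf{C}}$. Then there is a propositional model $(M,\mathfrak{m})$ of $\mathbf{P}$ such that for all $X\in\mathsf{C}$, $F_X=\{\alpha\in\mathbf{P}(X)\mid\text{for all }x\in M(X),\ x\in\mathfrak{m}_X(\alpha)\}$.
   Context: Categories have finite products; $\mathbf{t}$ is terminal, $\mathrm{pr}_i$ projections. A Boolean doctrine over $\mathsf{C}$ is a functor $\mathbf{P}\colon\mathsf{C}^{\mathrm{op}}\to\mathsf{BA}$. A Boolean doctrine morphism is a pair $(M,\mathfrak{m})$ of a finite-product-preserving functor $M$ between base categories and a natural transformation $\mathfrak{m}\colon\mathbf{P}\Rightarrow\mathbf{R}\circ M^{\mathrm{op}}$. The subsets doctrine $\mathscr{P}\colon\mathsf{Set}^{\mathrm{op}}\to\mathsf{BA}$ sends a set to its power set and a function to preimage; a propositional model of $\mathbf{P}$ is a Boolean doctrine morphism $(M,\mathfrak{m})\colon\mathbf{P}\to\mathscr{P}$. A universal ultrafilter for $\mathbf{P}$ is a family $(F_X)_{X\in\mathsf{C}}$, $F_X\subseteq\mathbf{P}(X)$, with: $\mathbf{P}(f)(\alpha)\in F_X$ for all $f\colon X\to Y$, $\alpha\in F_Y$; each $F_X$ a filter; if $\mathbf{P}(\mathrm{pr}_1)(\alpha_1)\lor\mathbf{P}(\mathrm{pr}_2)(\alpha_2)\in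 F_{X_1\times X_2}$ then $\alpha_1\in F_{X_1}$ or $\alpha_2\in F_{X_2}$; $\bot_{\mathbf{P}(\mathbf{t})}\notin F_{\mathbf{t}}$. $\mathbf{P}$ is rich with respect to $(F_X)$ if for all $X$ and $\alpha\in\mathbf{P}(X)\setminus F_X$ there is $c\colon\mathbf{t}\to X$ with $\mathbf{P}(c)(\alpha)\notin F_{\mathbf{t}}$. -}

module Defs where

open import Level using (Level; _⊔_; suc)
open import Data.Product using (Σ; _×_; _,_; ∃!)
open import Data.Sum using (_⊎_)
open import Relation.Nullary using (¬_)
open import Relation.Binary.PropositionalEquality using (_≡_)
open import Function.Bundles using (_⇔_)
open import Algebra.Lattice.Bundles using (BooleanAlgebra)

record FPCat (o h : Level) : Set (suc (o ⊔ h)) where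
  infixr 9 _∘_
  infixr 7 _×ᶜ_
  field
    Obj  : Set o
    Hom  : Obj → Obj → Set h
    id   : ∀ {X} → Hom X X
    _∘_  : ∀ {X Y Z} → Hom Y Z → Hom X Y → Hom X Z
    identityˡ : ∀ {X Y} (f : Hom X Y) → id ∘ f ≡ f
    identityʳ : ∀ {X Y} (f : Hom X Y) → f ∘ id ≡ f
    assoc     : ∀ {W X Y Z} (f : Hom W X) (g : Hom X Y) (k : Hom Y Z) →
                (k ∘ g) ∘ f ≡ k ∘ (g ∘ f)
    𝐭       : Obj
    !       : ∀ X → Hom X 𝐭
    !-unique : ∀ {X} (f : Hom X 𝐭) → f ≡ ! X
    _×ᶜ_    : Obj → Obj → Obj
    pr₁     : ∀ {X Y} → Hom (X ×ᶜ Y) X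
    pr₂     : ∀ {X Y} → Hom (X ×ᶜ Y) Y
    ⟨_,_⟩   : ∀ {Z X Y} → Hom Z X → Hom Z Y → Hom Z (X ×ᶜ Y)
    pr₁∘⟨⟩  : ∀ {Z X Y} (f : Hom Z X) (g : Hom Z Y) → pr₁ ∘ ⟨ f , g ⟩ ≡ f
    pr₂∘⟨⟩  : ∀ {Z X Y} (f : Hom Z X) (g : Hom Z Y) → pr₂ ∘ ⟨ f , g ⟩ ≡ g
    ⟨⟩-unique : ∀ {Z X Y} (f : Hom Z X) (g : Hom Z Y) (k : Hom Z (X ×ᶜ Y)) →
                pr₁ ∘ k ≡ f → pr₂ ∘ k ≡ g → k ≡ ⟨ f , g ⟩

record BooleanDoctrine {o h} (C : FPCat o h) (c ℓ : Level)
       : Set (o ⊔ h ⊔ suc (c ⊔ ℓ)) where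
  open FPCat C
  field
    P  : Obj → BooleanAlgebra c ℓ
  open BooleanAlgebra using (Carrier)
  module PX (X : Obj) = BooleanAlgebra (P X)
  field
    P₁ : ∀ {X Y} → Hom X Y → Carrier (P Y) → Carrier (P X)
    P₁-cong : ∀ {X Y} (f : Hom X Y) {α β} → PX._≈_ Y α β → PX._≈_ X (P₁ f α) (P₁ f β)
    P₁-∧ : ∀ {X Y} (f : Hom X Y) α β →
           PX._≈_ X (P₁ f (PX._∧_ Y α β)) (PX._∧_ X (P₁ f α) (P₁ f β))
    P₁-∨ : ∀ {X Y} (f : Hom X Y) α β →
           PX._≈_ X (P₁ f (PX._∨_ Y α β)) (PX._∨_ X (P₁ f α) (P₁ f β))
    P₁-¬ : ∀ {X Y} (f : Hom X Y) α →
           PX._≈_ X (P₁ f (PX.¬_ Y α)) (PX.¬_ X (P₁ f α))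
    P₁-⊤ : ∀ {X Y} (f : Hom X Y) → PX._≈_ X (P₁ f (PX.⊤ Y)) (PX.⊤ X)
    P₁-⊥ : ∀ {X Y} (f : Hom X Y) → PX._≈_ X (P₁ f (PX.⊥ Y)) (PX.⊥ X)
    P₁-id : ∀ {X} α → PX._≈_ X (P₁ (id {X}) α) α
    P₁-∘  : ∀ {X Y Z} (f : Hom X Y) (g : Hom Y Z) α →
            PX._≈_ X (P₁ (g ∘ f) α) (P₁ f (P₁ g α))

-- Filters on a Boolean algebra (order: α ≤ β iff α ∧ β ≈ α)

record IsFilter {c ℓ} (B : BooleanAlgebra c ℓ) {f} (F : BooleanAlgebra.Carrier B → Set f)
       : Set (c ⊔ ℓ ⊔ f) where
  open BooleanAlgebra B
  field
    ⊤∈   : F ⊤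
    ∧∈   : ∀ {α β} → F α → F β → F (α ∧ β)
    up   : ∀ {α β} → F α → (α ∧ β) ≈ α → F β

module _ {o h c ℓ} {C : FPCat o h} (D : BooleanDoctrine C c ℓ) where
  open FPCat C
  open BooleanDoctrine D
  open BooleanAlgebra using (Carrier)

  record UniversalUltrafilter {f} (F : (X : Obj) → Carrier (P X) → Set f)
         : Set (o ⊔ h ⊔ c ⊔ ℓ ⊔ f) where
    field
      stable : ∀ {X Y} (g : Hom X Y) {α} → F Y α → F X (P₁ g α)
      filter : ∀ X → IsFilter (P X) (F X)
      prime  : ∀ {X₁ X₂} α₁ α₂ →
               F (X₁ ×ᶜ X₂) (PX._∨_ (X₁ ×ᶜ X₂) (P₁ pr₁ α₁) (P₁ pr₂ α₂)) →
               F X₁ α₁ ⊎ F X₂ α₂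
      proper : ¬ F 𝐭 (PX.⊥ 𝐭)

  Rich : ∀ {f} → ((X : Obj) → Carrier (P X) → Set f) → Set (o ⊔ h ⊔ c ⊔ f)
  Rich F = ∀ X α → ¬ F X α → Σ (Hom 𝐭 X) λ x → ¬ F 𝐭 (P₁ x α)

  -- Propositional models: Boolean doctrine morphisms (M , m) : P → 𝒫,
  -- where 𝒫 is the subsets doctrine on Set.  A subset of a set S is a
  -- predicate S → Set p; equality of subsets is extensional (⇔), and
  -- 𝒫(g) is preimage.  m_X is required to be a Boolean algebra
  -- homomorphism P(X) → 𝒫(M X), natural in X.

  record PropositionalModel (s p : Level) : Set (o ⊔ h ⊔ c ⊔ ℓ ⊔ suc (s ⊔ p)) where
    field
      M₀ : Obj → Set s
      M₁ : ∀ {X Y} → Hom X Y → M₀ X → M₀ Y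
      M-id : ∀ {X} (x : M₀ X) → M₁ (id {X}) x ≡ x
      M-∘  : ∀ {X Y Z} (f : Hom X Y) (g : Hom Y Z) (x : M₀ X) →
             M₁ (g ∘ f) x ≡ M₁ g (M₁ f x)
      M-𝐭  : Σ (M₀ 𝐭) λ u → ∀ v → v ≡ u
      M-×  : ∀ {X Y} (a : M₀ X) (b : M₀ Y) →
             ∃! _≡_ λ (z : M₀ (X ×ᶜ Y)) → (M₁ pr₁ z ≡ a) × (M₁ pr₂ z ≡ b)
      m  : ∀ X → Carrier (P X) → M₀ X → Set p
      m-cong : ∀ {X α β} → PX._≈_ X α β → ∀ x → m X α x ⇔ m X β x
      m-⊤ : ∀ {X} x → m X (PX.⊤ X) x
      m-⊥ : ∀ {X} x → ¬ m X (PX.⊥ X) x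
      m-∧ : ∀ {X} α β x → m X (PX._∧_ X α β) x ⇔ (m X α x × m X β x)
      m-∨ : ∀ {X} α β x → m X (PX._∨_ X α β) x ⇔ (m X α x ⊎ m X β x)
      m-¬ : ∀ {X} α x → m X (PX.¬_ X α) x ⇔ (¬ m X α x)
      m-natural : ∀ {X Y} (g : Hom X Y) α x → m X (P₁ g α) x ⇔ m Y α (M₁ g x)

{-# OPTIONS --safe #-}

-- The model is the functor of global elements Hom(𝐭, –), with x ∈ m_X(α)
-- iff P(x)(α) ∈ F_𝐭.  Since the two projections 𝐭 × 𝐭 → 𝐭 coincide, F_𝐭 is
-- a proper prime filter, i.e. membership in F_𝐭 is a Boolean homomorphism
-- into truth values; this makes m a morphism of Boolean doctrines.
-- Stability of F gives F_X ⊆ {α | every x ∈ m_X(α)}, and richness (read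
-- with excluded middle) gives the converse.

module Submission where

open import Defs
open import Level using (Level)
open import Data.Product using (Σ; _,_; _×_)
open import Data.Sum using (_⊎_; [_,_])
open import Data.Empty using (⊥-elim)
open import Relation.Nullary using (¬_; yes; no)
open import Relation.Binary.PropositionalEquality as ≡ using (_≡_)
open import Function using (_∘′_)
open import Function.Bundles using (_⇔_; mk⇔)
open import Function.Construct.Composition using (_⇔-∘_)
open import Algebra.Lattice.Bundles using (BooleanAlgebra)
open import Axiom.ExcludedMiddle using (ExcludedMiddle)
import Algebra.Lattice.Properties.BooleanAlgebra as BooleanAlgebraProperties
import Relation.Binary.Reasoning.Setoid as SetoidReasoning

module FilterProperties {c ℓ f} (B : BooleanAlgebra c ℓ)
                        {F : BooleanAlgebra.Carrier B → Set f}
                        (isFilter : IsFilter B F) where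
  open BooleanAlgebra B
  open BooleanAlgebraProperties B
  open IsFilter isFilter
  open SetoidReasoning setoid

  resp-≈ : ∀ {a b} → a ≈ b → F a → F b
  resp-≈ {a} {b} a≈b Fa = up Fa (begin
    a ∧ b ≈⟨ ∧-congˡ (sym a≈b) ⟩
    a ∧ a ≈⟨ ∧-idem a ⟩
    a     ∎)

  resp-⇔ : ∀ {a b} → a ≈ b → F a ⇔ F b
  resp-⇔ a≈b = mk⇔ (resp-≈ a≈b) (resp-≈ (sym a≈b))

  ∧-projˡ : ∀ {a b} → F (a ∧ b) → F a
  ∧-projˡ {a} {b} Fa∧b = up Fa∧b (begin
    (a ∧ b) ∧ a ≈⟨ ∧-comm _ _ ⟩
    a ∧ (a ∧ b) ≈⟨ sym (∧-assoc _ _ _) ⟩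
    (a ∧ a) ∧ b ≈⟨ ∧-congʳ (∧-idem a) ⟩
    a ∧ b       ∎)

  ∧-projʳ : ∀ {a b} → F (a ∧ b) → F b
  ∧-projʳ = ∧-projˡ ∘′ resp-≈ (∧-comm _ _)

  ∨-injˡ : ∀ {a b} → F a → F (a ∨ b)
  ∨-injˡ Fa = up Fa (∧-absorbs-∨ _ _)

  ∨-injʳ : ∀ {a b} → F b → F (a ∨ b)
  ∨-injʳ = resp-≈ (∨-comm _ _) ∘′ ∨-injˡ

module ProperPrimeFilter {c ℓ f} (B : BooleanAlgebra c ℓ)
                         {F : BooleanAlgebra.Carrier B → Set f}
                         (isFilter : IsFilter B F)
                         (prime : ∀ a b → F (BooleanAlgebra._∨_ B a b) → F a ⊎ F b)
                         (proper : ¬ F (BooleanAlgebra.⊥ B)) where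
  open BooleanAlgebra B renaming (¬_ to ∁_)
  open IsFilter isFilter
  open FilterProperties B isFilter

  ∧-⇔ : ∀ {a b} → F (a ∧ b) ⇔ (F a × F b)
  ∧-⇔ = mk⇔ (λ Fa∧b → ∧-projˡ Fa∧b , ∧-projʳ Fa∧b)
            (λ (Fa , Fb) → ∧∈ Fa Fb)

  ∨-⇔ : ∀ {a b} → F (a ∨ b) ⇔ (F a ⊎ F b)
  ∨-⇔ = mk⇔ (prime _ _) [ ∨-injˡ , ∨-injʳ ]

  ¬-⇔ : ∀ {a} → F (∁ a) ⇔ (¬ F a)
  ¬-⇔ {a} = mk⇔ (λ F¬a Fa → proper (resp-≈ (∧-complementʳ a) (∧∈ Fa F¬a)))
                (λ ¬Fa → [ ⊥-elim ∘′ ¬Fa , (λ F¬a → F¬a) ]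
                           (prime a (∁ a) (resp-≈ (sym (∨-complementʳ a)) ⊤∈)))

module GlobalElements {o h c ℓ f} {C : FPCat o h} (D : BooleanDoctrine C c ℓ)
                      {F : (X : FPCat.Obj C) → BooleanAlgebra.Carrier (BooleanDoctrine.P D X) → Set f}
                      (UF : UniversalUltrafilter D F) where
  open FPCat C
  open BooleanDoctrine D
  open UniversalUltrafilter UF
  open module P𝐭 = BooleanAlgebra (P 𝐭) using (_∨_)

  maps-into-𝐭-equal : ∀ {X} (g k : Hom X 𝐭) → g ≡ k
  maps-into-𝐭-equal g k = ≡.trans (!-unique g) (≡.sym (!-unique k))

  -- Pull back along pr₁ = pr₂ : 𝐭 × 𝐭 → 𝐭 and apply primeness on 𝐭 × 𝐭.
  prime-at-𝐭 : ∀ a b → F 𝐭 (a ∨ b) → F 𝐭 a ⊎ F 𝐭 b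
  prime-at-𝐭 a b Fa∨b = prime a b
    (≡.subst (λ q → F (𝐭 ×ᶜ 𝐭) (PX._∨_ (𝐭 ×ᶜ 𝐭) (P₁ pr₁ a) (P₁ q b)))
             (maps-into-𝐭-equal pr₁ pr₂)
             (FilterProperties.resp-≈ (P (𝐭 ×ᶜ 𝐭)) (filter (𝐭 ×ᶜ 𝐭)) (P₁-∨ pr₁ a b)
                                      (stable pr₁ Fa∨b)))

  open FilterProperties (P 𝐭) (filter 𝐭)
  open ProperPrimeFilter (P 𝐭) (filter 𝐭) prime-at-𝐭 proper

  model : PropositionalModel D h f
  model = record
    { M₀ = Hom 𝐭
    ; M₁ = _∘_
    ; M-id = identityˡ
    ; M-∘ = λ g k x → assoc x g k
    ; M-𝐭 = ! 𝐭 , !-unique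
    ; M-× = λ a b → ⟨ a , b ⟩ , (pr₁∘⟨⟩ a b , pr₂∘⟨⟩ a b)
                  , λ (pr₁≡a , pr₂≡b) → ≡.sym (⟨⟩-unique a b _ pr₁≡a pr₂≡b)
    ; m = λ X α x → F 𝐭 (P₁ x α)
    ; m-cong = λ α≈β x → resp-⇔ (P₁-cong x α≈β)
    ; m-⊤ = λ x → resp-≈ (P𝐭.sym (P₁-⊤ x)) (IsFilter.⊤∈ (filter 𝐭))
    ; m-⊥ = λ x → proper ∘′ resp-≈ (P₁-⊥ x)
    ; m-∧ = λ α β x → ∧-⇔ ⇔-∘ resp-⇔ (P₁-∧ x α β)
    ; m-∨ = λ α β x → ∨-⇔ ⇔-∘ resp-⇔ (P₁-∨ x α β)
    ; m-¬ = λ α x → ¬-⇔ ⇔-∘ resp-⇔ (P₁-¬ x α)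
    ; m-natural = λ g α x → resp-⇔ (P𝐭.sym (P₁-∘ x g α))
    }

  rich⇒∈-if-∈-at-global-elements : ExcludedMiddle f → Rich D F →
    ∀ X α → (∀ (x : Hom 𝐭 X) → F 𝐭 (P₁ x α)) → F X α
  rich⇒∈-if-∈-at-global-elements em rich X α everywhere with em {F X α}
  ... | yes Fα = Fα
  ... | no ¬Fα = let (x , ¬Fxα) = rich X α ¬Fα in ⊥-elim (¬Fxα (everywhere x))

proposition3p22 : ∀ {o h c ℓ f : Level} → ExcludedMiddle f →
    (C : FPCat o h) (D : BooleanDoctrine C c ℓ) →
    (F : (X : FPCat.Obj C) → BooleanAlgebra.Carrier (BooleanDoctrine.P D X) → Set f) →
    UniversalUltrafilter D F → Rich D F →
    Σ (PropositionalModel D h f) λ Mm →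
      ∀ X α → F X α ⇔ (∀ x → PropositionalModel.m Mm X α x)
proposition3p22 em C D F UF rich =
  model , λ X α → mk⇔ (λ Fα x → stable x Fα)
                      (rich⇒∈-if-∈-at-global-elements em rich X α)
  where
  open GlobalElements D UF
  open UniversalUltrafilter UF using (stable)
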